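{- Every structurally complete variety of closure algebras satisfies the McKinsey identity $(\forall x)\,\Box\Diamond x\Rightarrow\Diamond\Box x\approx1$.
   Context: A closure algebra is a Boolean algebra with unary $\Diamond$ satisfying $\Diamond0=0$, $\Diamond(a\vee b)=\Diamond a\vee\Diamond b$, $a\le\Diamond a=\Diamond\Diamond a$; $\Box x=\neg\Diamond\neg x$ and $a\Rightarrow b=\neg a\vee b$. A variety $\mathcal U$ is structurally complete if every quasi-identity true in its free algebra of countably infinite rank holds in all of $\mathcal U$. -}

module Defs where

open import Level using (Level; _⊔_; suc; 0ℓ)
open import Data.Nat using (ℕ)
open import Data.Product using (_×_; _,_)
open import Data.List using (List)
open import Data.List.Relation.Unary.All using (All)
open import Algebra.Lattice.Bundles using (BooleanAlgebra)

record ClosureAlgebra (c ℓ : Level) : Set (suc (c ⊔ ℓ)) where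
  field
    booleanAlgebra : BooleanAlgebra c ℓ
  open BooleanAlgebra booleanAlgebra public
  field
    ◇      : Carrier → Carrier
    ◇-cong : ∀ {a b} → a ≈ b → ◇ a ≈ ◇ b
    ◇-⊥    : ◇ ⊥ ≈ ⊥
    ◇-∨    : ∀ a b → ◇ (a ∨ b) ≈ (◇ a ∨ ◇ b)
    ◇-incr : ∀ a → (a ∨ ◇ a) ≈ ◇ a          -- a ≤ ◇ a
    ◇-idem : ∀ a → ◇ (◇ a) ≈ ◇ a

infixr 6 _∨'_
infixr 7 _∧'_

data Term : Set where
  var   : ℕ → Term
  _∨'_  : Term → Term → Term
  _∧'_  : Term → Term → Term
  ¬'_   : Term → Term
  ⊤'    : Term
  ⊥'    : Term
  ◇'_   : Term → Term

□' : Term → Term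
□' t = ¬' (◇' (¬' t))

_⇒'_ : Term → Term → Term
a ⇒' b = (¬' a) ∨' b

Identity : Set
Identity = Term × Term

record QuasiIdentity : Set where
  constructor _⟹_
  field
    premises   : List Identity
    conclusion : Identity

-- Structures for the signature (setoid carrier, no laws required);
-- used to interpret terms both in closure algebras and in free algebras.

record Structure (c ℓ : Level) : Set (suc (c ⊔ ℓ)) where
  field
    Carrier : Set c
    _≈_     : Carrier → Carrier → Set ℓ
    _∨_ _∧_ : Carrier → Carrier → Carrier
    ¬_      : Carrier → Carrier
    ⊤ ⊥     : Carrier
    ◇       : Carrier → Carrier

module _ {c ℓ : Level} (S : Structure c ℓ) where
  open Structure S

  ⟦_⟧ : Term → (ℕ → Carrier) → Carrier
  ⟦ var i  ⟧ ρ = ρ i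
  ⟦ s ∨' t ⟧ ρ = ⟦ s ⟧ ρ ∨ ⟦ t ⟧ ρ
  ⟦ s ∧' t ⟧ ρ = ⟦ s ⟧ ρ ∧ ⟦ t ⟧ ρ
  ⟦ ¬' t   ⟧ ρ = ¬ (⟦ t ⟧ ρ)
  ⟦ ⊤'     ⟧ ρ = ⊤
  ⟦ ⊥'     ⟧ ρ = ⊥
  ⟦ ◇' t   ⟧ ρ = ◇ (⟦ t ⟧ ρ)

  HoldsAt : Identity → (ℕ → Carrier) → Set ℓ
  HoldsAt (s , t) ρ = ⟦ s ⟧ ρ ≈ ⟦ t ⟧ ρ

  SatId : Identity → Set (c ⊔ ℓ)
  SatId e = ∀ (ρ : ℕ → Carrier) → HoldsAt e ρ

  SatQ : QuasiIdentity → Set (c ⊔ ℓ)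
  SatQ (ps ⟹ e) = ∀ (ρ : ℕ → Carrier) → All (λ p → HoldsAt p ρ) ps → HoldsAt e ρ

toStructure : ∀ {c ℓ} → ClosureAlgebra c ℓ → Structure c ℓ
toStructure A = record
  { Carrier = Carrier ; _≈_ = _≈_ ; _∨_ = _∨_ ; _∧_ = _∧_ ; ¬_ = ¬_
  ; ⊤ = ⊤ ; ⊥ = ⊥ ; ◇ = ◇ }
  where open ClosureAlgebra A

-- Varieties of closure algebras, given (Birkhoff) by a set E of identities:
-- U = { closure algebras A | A ⊨ e for all e ∈ E }.

Variety : Set₁
Variety = Identity → Set

module _ (c ℓ : Level) (U : Variety) where

  InVariety : ClosureAlgebra c ℓ → Set (c ⊔ ℓ)
  InVariety A = ∀ e → U e → SatId (toStructure A) e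

  _⊨V_ : Identity → Set (suc (c ⊔ ℓ))
  _⊨V_ e = (A : ClosureAlgebra c ℓ) → InVariety A → SatId (toStructure A) e

  -- The free algebra F_U(ω) of countably infinite rank: terms in the
  -- variables x₀, x₁, … modulo the equational theory of U
  -- (a setoid quotient, so no laws need to be constructed here).
  FreeAlgebra : Structure 0ℓ (suc (c ⊔ ℓ))
  FreeAlgebra = record
    { Carrier = Term
    ; _≈_ = λ s t → _⊨V_ (s , t)
    ; _∨_ = _∨'_ ; _∧_ = _∧'_ ; ¬_ = ¬'_ ; ⊤ = ⊤' ; ⊥ = ⊥' ; ◇ = ◇'_ }

  StructurallyComplete : Set (suc (c ⊔ ℓ))
  StructurallyComplete =
    (q : QuasiIdentity) → SatQ FreeAlgebra q →
    (A : ClosureAlgebra c ℓ) → InVariety A → SatQ (toStructure A) q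

McKinsey : Identity
McKinsey = ((□' (◇' (var 0))) ⇒' (◇' (□' (var 0)))) , ⊤'

module Submission where

-- For an element a of a closure algebra A in U, the element b = □◇a ∧ □◇¬a
-- is open, so relativizing A to b (identifying x and y when x ∧ b = y ∧ b)
-- is again an algebra of U, in which □◇a ∧ □◇¬a = 1.  The quasi-identity
-- □◇x ∧ □◇¬x ≈ 1 ⟹ 0 ≈ 1 holds in the free algebra F_U(ω): substituting 0
-- for every variable sends any term to 0 or 1, and there □◇t ∧ □◇¬t = 0.
-- By structural completeness it holds in the relativization, which is
-- therefore trivial; that is, b = 0 in A, which is the McKinsey identity at a.

open import Defs
open import Level using (Level)
open import Data.Product using (_,_)
open import Data.Sum using (_⊎_; inj₁; inj₂)
open import Data.List using ([]; _∷_)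
open import Data.List.Relation.Unary.All using ([]; _∷_)
open import Relation.Binary.PropositionalEquality as ≡ using (_≡_)
open import Algebra.Bundles using (IdempotentCommutativeMonoid)
import Algebra.Lattice.Properties.BooleanAlgebra as BooleanAlgebraProperties
import Algebra.Properties.IdempotentCommutativeMonoid as IdempotentCommutativeMonoidProperties
import Relation.Binary.Reasoning.Setoid as SetoidReasoning

module ClosureAlgebraProperties {c ℓ : Level} (A : ClosureAlgebra c ℓ) where
  open ClosureAlgebra A
  open BooleanAlgebraProperties booleanAlgebra
  open SetoidReasoning setoid

  □ : Carrier → Carrier
  □ x = ¬ ◇ (¬ x)

  □-cong : ∀ {x y} → x ≈ y → □ x ≈ □ y
  □-cong x≈y = ¬-cong (◇-cong (¬-cong x≈y))

  ◇-⊤ : ◇ ⊤ ≈ ⊤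
  ◇-⊤ = trans (sym (◇-incr ⊤)) (∨-zeroˡ _)

  □◇⊥≈⊥ : □ (◇ ⊥) ≈ ⊥
  □◇⊥≈⊥ = begin
    ¬ ◇ (¬ ◇ ⊥) ≈⟨ ¬-cong (◇-cong (¬-cong ◇-⊥)) ⟩
    ¬ ◇ (¬ ⊥)   ≈⟨ ¬-cong (◇-cong ¬⊥≈⊤) ⟩
    ¬ ◇ ⊤       ≈⟨ ¬-cong ◇-⊤ ⟩
    ¬ ⊤         ≈⟨ ¬⊤≈⊥ ⟩
    ⊥           ∎

  □-∧ : ∀ x y → □ (x ∧ y) ≈ □ x ∧ □ y
  □-∧ x y = begin
    ¬ ◇ (¬ (x ∧ y))       ≈⟨ ¬-cong (◇-cong (deMorgan₁ x y)) ⟩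
    ¬ ◇ (¬ x ∨ ¬ y)       ≈⟨ ¬-cong (◇-∨ _ _) ⟩
    ¬ (◇ (¬ x) ∨ ◇ (¬ y)) ≈⟨ deMorgan₂ _ _ ⟩
    □ x ∧ □ y             ∎

  □-idem : ∀ x → □ (□ x) ≈ □ x
  □-idem x = ¬-cong (trans (◇-cong (¬-involutive _)) (◇-idem _))

  □x∧□y-open : ∀ x y → □ (□ x ∧ □ y) ≈ □ x ∧ □ y
  □x∧□y-open x y = trans (□-∧ _ _) (∧-cong (□-idem x) (□-idem y))

  ◇[x∧y]≤◇y : ∀ x y → ◇ (x ∧ y) ∧ ◇ y ≈ ◇ (x ∧ y)
  ◇[x∧y]≤◇y x y = begin
    ◇ (x ∧ y) ∧ ◇ y                 ≈⟨ ∧-congˡ (◇-cong x∧y∨y≈y) ⟨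
    ◇ (x ∧ y) ∧ ◇ (x ∧ y ∨ y)       ≈⟨ ∧-congˡ (◇-∨ _ _) ⟩
    ◇ (x ∧ y) ∧ (◇ (x ∧ y) ∨ ◇ y)   ≈⟨ ∧-absorbs-∨ _ _ ⟩
    ◇ (x ∧ y)                       ∎
    where
    x∧y∨y≈y : x ∧ y ∨ y ≈ y
    x∧y∨y≈y = trans (∨-comm _ _) (trans (∨-congˡ (∧-comm _ _)) (∨-absorbs-∧ _ _))

  ◇[x∧¬y]∧□y≈⊥ : ∀ x y → ◇ (x ∧ ¬ y) ∧ □ y ≈ ⊥
  ◇[x∧¬y]∧□y≈⊥ x y = begin
    ◇ (x ∧ ¬ y) ∧ ¬ ◇ (¬ y)               ≈⟨ ∧-congʳ (◇[x∧y]≤◇y x (¬ y)) ⟨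
    (◇ (x ∧ ¬ y) ∧ ◇ (¬ y)) ∧ ¬ ◇ (¬ y)   ≈⟨ ∧-assoc _ _ _ ⟩
    ◇ (x ∧ ¬ y) ∧ (◇ (¬ y) ∧ ¬ ◇ (¬ y))   ≈⟨ ∧-congˡ (∧-complementʳ _) ⟩
    ◇ (x ∧ ¬ y) ∧ ⊥                       ≈⟨ ∧-zeroʳ _ ⟩
    ⊥                                     ∎

  □◇∧□◇¬≈⊥⇒McKinsey : ∀ a → □ (◇ a) ∧ □ (◇ (¬ a)) ≈ ⊥ → ¬ □ (◇ a) ∨ ◇ (□ a) ≈ ⊤
  □◇∧□◇¬≈⊥⇒McKinsey a h = begin
    ¬ □ (◇ a) ∨ ◇ (□ a)         ≈⟨ ∨-congˡ (¬-involutive _) ⟨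
    ¬ □ (◇ a) ∨ ¬ □ (◇ (¬ a))   ≈⟨ deMorgan₁ _ _ ⟨
    ¬ (□ (◇ a) ∧ □ (◇ (¬ a)))   ≈⟨ ¬-cong h ⟩
    ¬ ⊥                         ≈⟨ ¬⊥≈⊤ ⟩
    ⊤                           ∎

  Bivalent : Carrier → Set ℓ
  Bivalent v = v ≈ ⊥ ⊎ v ≈ ⊤

  bivalent-∨ : ∀ {x y} → Bivalent x → Bivalent y → Bivalent (x ∨ y)
  bivalent-∨ (inj₁ x≈⊥) (inj₁ y≈⊥) = inj₁ (trans (∨-cong x≈⊥ y≈⊥) (∨-identityˡ _))
  bivalent-∨ (inj₁ x≈⊥) (inj₂ y≈⊤) = inj₂ (trans (∨-congˡ y≈⊤) (∨-zeroʳ _))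
  bivalent-∨ (inj₂ x≈⊤) _          = inj₂ (trans (∨-congʳ x≈⊤) (∨-zeroˡ _))

  bivalent-∧ : ∀ {x y} → Bivalent x → Bivalent y → Bivalent (x ∧ y)
  bivalent-∧ (inj₁ x≈⊥) _          = inj₁ (trans (∧-congʳ x≈⊥) (∧-zeroˡ _))
  bivalent-∧ (inj₂ x≈⊤) (inj₁ y≈⊥) = inj₁ (trans (∧-congˡ y≈⊥) (∧-zeroʳ _))
  bivalent-∧ (inj₂ x≈⊤) (inj₂ y≈⊤) = inj₂ (trans (∧-cong x≈⊤ y≈⊤) (∧-identityˡ _))

  bivalent-¬ : ∀ {x} → Bivalent x → Bivalent (¬ x)
  bivalent-¬ (inj₁ x≈⊥) = inj₂ (trans (¬-cong x≈⊥) ¬⊥≈⊤)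
  bivalent-¬ (inj₂ x≈⊤) = inj₁ (trans (¬-cong x≈⊤) ¬⊤≈⊥)

  bivalent-◇ : ∀ {x} → Bivalent x → Bivalent (◇ x)
  bivalent-◇ (inj₁ x≈⊥) = inj₁ (trans (◇-cong x≈⊥) ◇-⊥)
  bivalent-◇ (inj₂ x≈⊤) = inj₂ (trans (◇-cong x≈⊤) ◇-⊤)

  ⟦⟧-at-⊥-bivalent : ∀ t → Bivalent (⟦ toStructure A ⟧ t (λ _ → ⊥))
  ⟦⟧-at-⊥-bivalent (var i)  = inj₁ refl
  ⟦⟧-at-⊥-bivalent (s ∨' t) = bivalent-∨ (⟦⟧-at-⊥-bivalent s) (⟦⟧-at-⊥-bivalent t)
  ⟦⟧-at-⊥-bivalent (s ∧' t) = bivalent-∧ (⟦⟧-at-⊥-bivalent s) (⟦⟧-at-⊥-bivalent t)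
  ⟦⟧-at-⊥-bivalent (¬' t)   = bivalent-¬ (⟦⟧-at-⊥-bivalent t)
  ⟦⟧-at-⊥-bivalent ⊤'       = inj₂ refl
  ⟦⟧-at-⊥-bivalent ⊥'       = inj₁ refl
  ⟦⟧-at-⊥-bivalent (◇' t)   = bivalent-◇ (⟦⟧-at-⊥-bivalent t)

  bivalent⇒□◇∧□◇¬≈⊥ : ∀ {v} → Bivalent v → □ (◇ v) ∧ □ (◇ (¬ v)) ≈ ⊥
  bivalent⇒□◇∧□◇¬≈⊥ (inj₁ v≈⊥) =
    trans (∧-congʳ (trans (□-cong (◇-cong v≈⊥)) □◇⊥≈⊥)) (∧-zeroˡ _)
  bivalent⇒□◇∧□◇¬≈⊥ (inj₂ v≈⊤) =
    trans (∧-congˡ (trans (□-cong (◇-cong (trans (¬-cong v≈⊤) ¬⊤≈⊥))) □◇⊥≈⊥)) (∧-zeroʳ _)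

  ∧-idempotentCommutativeMonoid : IdempotentCommutativeMonoid c ℓ
  ∧-idempotentCommutativeMonoid = record
    { isIdempotentCommutativeMonoid = record
      { isCommutativeMonoid = ∧-⊤-isCommutativeMonoid ; idem = ∧-idem } }

  open IdempotentCommutativeMonoidProperties ∧-idempotentCommutativeMonoid
    using () renaming (∙-distrʳ-∙ to ∧-distribʳ-∧)

  -- The quotient of A by the principal filter of b, a congruence because b is open.
  module Relativization (b : Carrier) (b-open : □ b ≈ b) where

    _≈ᵇ_ : Carrier → Carrier → Set ℓ
    x ≈ᵇ y = x ∧ b ≈ y ∧ b

    ≈⇒≈ᵇ : ∀ {x y} → x ≈ y → x ≈ᵇ y
    ≈⇒≈ᵇ = ∧-congʳ

    ¬-relative : ∀ x → ¬ x ∧ b ≈ ¬ (x ∧ b) ∧ b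
    ¬-relative x = sym (begin
      ¬ (x ∧ b) ∧ b           ≈⟨ ∧-congʳ (deMorgan₁ _ _) ⟩
      (¬ x ∨ ¬ b) ∧ b         ≈⟨ ∧-distribʳ-∨ _ _ _ ⟩
      (¬ x ∧ b) ∨ (¬ b ∧ b)   ≈⟨ ∨-congˡ (∧-complementˡ _) ⟩
      (¬ x ∧ b) ∨ ⊥           ≈⟨ ∨-identityʳ _ ⟩
      ¬ x ∧ b                 ∎)

    -- The part of x outside b contributes nothing below b, since b is open.
    ◇-relative : ∀ x → ◇ x ∧ b ≈ ◇ (x ∧ b) ∧ b
    ◇-relative x = begin
      ◇ x ∧ b                                 ≈⟨ ∧-congʳ (◇-cong x≈x∧b∨x∧¬b) ⟩
      ◇ ((x ∧ b) ∨ (x ∧ ¬ b)) ∧ b             ≈⟨ ∧-congʳ (◇-∨ _ _) ⟩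
      (◇ (x ∧ b) ∨ ◇ (x ∧ ¬ b)) ∧ b           ≈⟨ ∧-distribʳ-∨ _ _ _ ⟩
      (◇ (x ∧ b) ∧ b) ∨ (◇ (x ∧ ¬ b) ∧ b)     ≈⟨ ∨-congˡ ◇[x∧¬b]∧b≈⊥ ⟩
      (◇ (x ∧ b) ∧ b) ∨ ⊥                     ≈⟨ ∨-identityʳ _ ⟩
      ◇ (x ∧ b) ∧ b                           ∎
      where
      x≈x∧b∨x∧¬b : x ≈ (x ∧ b) ∨ (x ∧ ¬ b)
      x≈x∧b∨x∧¬b = sym (begin
        (x ∧ b) ∨ (x ∧ ¬ b)   ≈⟨ ∧-distribˡ-∨ _ _ _ ⟨
        x ∧ (b ∨ ¬ b)         ≈⟨ ∧-congˡ (∨-complementʳ _) ⟩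
        x ∧ ⊤                 ≈⟨ ∧-identityʳ _ ⟩
        x                     ∎)
      ◇[x∧¬b]∧b≈⊥ : ◇ (x ∧ ¬ b) ∧ b ≈ ⊥
      ◇[x∧¬b]∧b≈⊥ = trans (∧-congˡ (sym b-open)) (◇[x∧¬y]∧□y≈⊥ x b)

    relative⇒≈ᵇ-cong : ∀ {f : Carrier → Carrier} → (∀ {x y} → x ≈ y → f x ≈ f y) →
                       (∀ x → f x ∧ b ≈ f (x ∧ b) ∧ b) → ∀ {x y} → x ≈ᵇ y → f x ≈ᵇ f y
    relative⇒≈ᵇ-cong f-cong f-relative x≈ᵇy =
      trans (f-relative _) (trans (∧-congʳ (f-cong x≈ᵇy)) (sym (f-relative _)))

    relativized : ClosureAlgebra c ℓ
    relativized = record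
      { booleanAlgebra = record
        { Carrier = Carrier ; _≈_ = _≈ᵇ_ ; _∨_ = _∨_ ; _∧_ = _∧_ ; ¬_ = ¬_
        ; ⊤ = ⊤ ; ⊥ = ⊥
        ; isBooleanAlgebra = record
          { isDistributiveLattice = record
            { isLattice = record
              { isEquivalence = record { refl = refl ; sym = sym ; trans = trans }
              ; ∨-comm     = λ x y → ≈⇒≈ᵇ (∨-comm x y)
              ; ∨-assoc    = λ x y z → ≈⇒≈ᵇ (∨-assoc x y z)
              ; ∨-cong     = λ p q → trans (∧-distribʳ-∨ _ _ _)
                               (trans (∨-cong p q) (sym (∧-distribʳ-∨ _ _ _)))
              ; ∧-comm     = λ x y → ≈⇒≈ᵇ (∧-comm x y)
              ; ∧-assoc    = λ x y z → ≈⇒≈ᵇ (∧-assoc x y z)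
              ; ∧-cong     = λ p q → trans (∧-distribʳ-∧ _ _ _)
                               (trans (∧-cong p q) (sym (∧-distribʳ-∧ _ _ _)))
              ; absorptive = (λ x y → ≈⇒≈ᵇ (∨-absorbs-∧ x y))
                           , (λ x y → ≈⇒≈ᵇ (∧-absorbs-∨ x y))
              }
            ; ∨-distrib-∧ = (λ x y z → ≈⇒≈ᵇ (∨-distribˡ-∧ x y z))
                          , (λ x y z → ≈⇒≈ᵇ (∨-distribʳ-∧ x y z))
            ; ∧-distrib-∨ = (λ x y z → ≈⇒≈ᵇ (∧-distribˡ-∨ x y z))
                          , (λ x y z → ≈⇒≈ᵇ (∧-distribʳ-∨ x y z))
            }
          ; ∨-complement = (λ x → ≈⇒≈ᵇ (∨-complementˡ x)) , (λ x → ≈⇒≈ᵇ (∨-complementʳ x))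
          ; ∧-complement = (λ x → ≈⇒≈ᵇ (∧-complementˡ x)) , (λ x → ≈⇒≈ᵇ (∧-complementʳ x))
          ; ¬-cong = relative⇒≈ᵇ-cong ¬-cong ¬-relative
          }
        }
      ; ◇      = ◇
      ; ◇-cong = relative⇒≈ᵇ-cong ◇-cong ◇-relative
      ; ◇-⊥    = ≈⇒≈ᵇ ◇-⊥
      ; ◇-∨    = λ x y → ≈⇒≈ᵇ (◇-∨ x y)
      ; ◇-incr = λ x → ≈⇒≈ᵇ (◇-incr x)
      ; ◇-idem = λ x → ≈⇒≈ᵇ (◇-idem x)
      }

    ⟦⟧-relativized : ∀ t ρ → ⟦ toStructure relativized ⟧ t ρ ≡ ⟦ toStructure A ⟧ t ρ
    ⟦⟧-relativized (var i)  ρ = ≡.refl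
    ⟦⟧-relativized (s ∨' t) ρ = ≡.cong₂ _∨_ (⟦⟧-relativized s ρ) (⟦⟧-relativized t ρ)
    ⟦⟧-relativized (s ∧' t) ρ = ≡.cong₂ _∧_ (⟦⟧-relativized s ρ) (⟦⟧-relativized t ρ)
    ⟦⟧-relativized (¬' t)   ρ = ≡.cong ¬_ (⟦⟧-relativized t ρ)
    ⟦⟧-relativized ⊤'       ρ = ≡.refl
    ⟦⟧-relativized ⊥'       ρ = ≡.refl
    ⟦⟧-relativized (◇' t)   ρ = ≡.cong ◇ (⟦⟧-relativized t ρ)

    relativized-⊨ : ∀ e → SatId (toStructure A) e → SatId (toStructure relativized) e
    relativized-⊨ (s , t) A⊨s≈t ρ
      rewrite ⟦⟧-relativized s ρ | ⟦⟧-relativized t ρ = ≈⇒≈ᵇ (A⊨s≈t ρ)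

    b≈ᵇ⊤ : b ≈ᵇ ⊤
    b≈ᵇ⊤ = trans (∧-idem b) (sym (∧-identityˡ b))

    ⊥≈ᵇ⊤⇒b≈⊥ : ⊥ ≈ᵇ ⊤ → b ≈ ⊥
    ⊥≈ᵇ⊤⇒b≈⊥ ⊥≈ᵇ⊤ = begin
      b       ≈⟨ ∧-identityˡ b ⟨
      ⊤ ∧ b   ≈⟨ ⊥≈ᵇ⊤ ⟨
      ⊥ ∧ b   ≈⟨ ∧-zeroˡ b ⟩
      ⊥       ∎

□◇x∧□◇¬x≈⊤⟹⊥≈⊤ : QuasiIdentity
□◇x∧□◇¬x≈⊤⟹⊥≈⊤ = (((□' (◇' x) ∧' □' (◇' (¬' x))) , ⊤') ∷ []) ⟹ (⊥' , ⊤')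
  where
  x : Term
  x = var 0

free⊨□◇x∧□◇¬x≈⊤⟹⊥≈⊤ : (c ℓ : Level) (U : Variety) → SatQ (FreeAlgebra c ℓ U) □◇x∧□◇¬x≈⊤⟹⊥≈⊤
free⊨□◇x∧□◇¬x≈⊤⟹⊥≈⊤ c ℓ U ρ (U⊨□◇t∧□◇¬t≈⊤ ∷ []) A A∈U _ =
  trans (sym (bivalent⇒□◇∧□◇¬≈⊥ (⟦⟧-at-⊥-bivalent (ρ 0)))) (U⊨□◇t∧□◇¬t≈⊤ A A∈U (λ _ → ⊥))
  where
  open ClosureAlgebra A
  open ClosureAlgebraProperties A

lemma8p5 : (c ℓ : Level) (U : Variety) → StructurallyComplete c ℓ U → _⊨V_ c ℓ U McKinsey
lemma8p5 c ℓ U U-structurallyComplete A A∈U σ = □◇∧□◇¬≈⊥⇒McKinsey a b≈⊥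
  where
  open ClosureAlgebra A
  open ClosureAlgebraProperties A
  a b : Carrier
  a = σ 0
  b = □ (◇ a) ∧ □ (◇ (¬ a))
  open Relativization b (□x∧□y-open (◇ a) (◇ (¬ a)))
  relativized∈U : InVariety c ℓ U relativized
  relativized∈U e e∈U = relativized-⊨ e (A∈U e e∈U)
  b≈⊥ : b ≈ ⊥
  b≈⊥ = ⊥≈ᵇ⊤⇒b≈⊥ (U-structurallyComplete □◇x∧□◇¬x≈⊤⟹⊥≈⊤ (free⊨□◇x∧□◇¬x≈⊤⟹⊥≈⊤ c ℓ U)
                    relativized relativized∈U σ (b≈ᵇ⊤ ∷ []))
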